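{- Let $n\ge 2$, let $w$ be a permutation of length $n-1$, and let $1\le j\le n$. Let $\mathrm{app}_j(w)$ (resp. $\mathrm{pre}_j(w)$) be the permutation of length $n$ obtained by increasing every entry of $w$ that is $\ge j$ by $1$ and then appending (resp. prepending) the entry $j$. For a permutation $u$ of length $n-1$ and $1\le k\le n$, let $\mathrm{ins}_{\max}(u,k)$ be the permutation of length $n$ obtained by inserting the entry $n$ into $u$ so that it occupies position $k$. Let $R_{\mathrm{cw}}$ and $R_{\mathrm{ccw}}$ denote clockwise and counter-clockwise $90^{\circ}$ rotation of the permutation matrix, where the permutation matrix of $u=u_1\ldots u_m$ has a $1$ in row $u_c$ (rows numbered from top to bottom) and column $c$; explicitly $R_{\mathrm{cw}}(u)_{m+1-u_c}=c$ and $R_{\mathrm{ccw}}(u)_{u_c}=m+1-c$ for all $c$. Then $$\mathrm{app}_j(w)=R_{\mathrm{ccw}}\big(\mathrm{ins}_{\max}(R_{\mathrm{cw}}(w),\,n+1-j)\big),\qquad \mathrm{pre}_j(w)=R_{\mathrm{cw}}\big(\mathrm{ins}_{\max}(R_{\mathrm{ccw}}(w),\,j)\big).$$ Consequently, if $w$ is a Baxter permutation, then $\mathrm{app}_j(w)$ is a Baxter permutation if and only if either ($j\le n-1$ and every entry of $w$ smaller than $j$ appears to the left of the entry $j$ in $w$) or ($j\ge 2$ and every entry of $w$ larger than $j-1$ appears to the left of the entry $j-1$ in $w$); and $\mathrm{pre}_j(w)$ is a Baxter permutation if and only if either ($j\le n-1$ and every entry of $w$ smaller than $j$ appears to the right of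 $j$ in $w$) or ($j\ge 2$ and every entry of $w$ larger than $j-1$ appears to the right of $j-1$ in $w$).
   Context: A permutation $w=w_1\ldots w_n$ is a Baxter permutation if there are no indices $i<j<j+1<k$ with $w_j<w_k<w_i<w_{j+1}$ (pattern 3-14-2) and no indices $i<j<j+1<k$ with $w_{j+1}<w_i<w_k<w_j$ (pattern 2-41-3). -}

module Defs where

open import Data.Nat using (ℕ; zero; suc; _+_; _∸_; _<_; _≤_; _≤ᵇ_; _≡ᵇ_)
open import Data.Bool using (if_then_else_)
open import Data.List using (List; []; _∷_; _++_; [_]; map; upTo; length; take; drop)
open import Data.List.Relation.Binary.Permutation.Propositional using (_↭_)
open import Data.Product using (_×_; ∃-syntax)
open import Relation.Binary.PropositionalEquality using (_≡_)
open import Relation.Nullary using (¬_)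

-- Permutations are lists in one-line notation with entries 1..m.

oneTo : ℕ → List ℕ
oneTo m = map suc (upTo m)

IsPerm : ℕ → List ℕ → Set
IsPerm m w = w ↭ oneTo m

-- 0-based access (default 0 out of range; only used in range)
at : List ℕ → ℕ → ℕ
at []       _       = 0
at (x ∷ xs) zero    = x
at (x ∷ xs) (suc i) = at xs i

-- 1-based position of entry x in u (u_{posOf x u} = x when x occurs)
posOf : ℕ → List ℕ → ℕ
posOf x []       = 0
posOf x (y ∷ ys) = if x ≡ᵇ y then 1 else suc (posOf x ys)

shift : ℕ → List ℕ → List ℕ
shift j = map (λ x → if j ≤ᵇ x then suc x else x)

app : ℕ → List ℕ → List ℕ
app j w = shift j w ++ [ j ]

pre : ℕ → List ℕ → List ℕ
pre j w = j ∷ shift j w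

insMax : List ℕ → ℕ → List ℕ
insMax u k = take (k ∸ 1) u ++ (suc (length u) ∷ drop (k ∸ 1) u)

-- clockwise rotation: Rcw(u)_{m+1-u_c} = c, i.e. Rcw(u)_i = position of (m+1-i) in u
Rcw : List ℕ → List ℕ
Rcw u = map (λ i → posOf (suc (length u) ∸ i) u) (oneTo (length u))

-- counter-clockwise rotation: Rccw(u)_{u_c} = m+1-c, i.e. Rccw(u)_i = m+1 - position of i in u
Rccw : List ℕ → List ℕ
Rccw u = map (λ i → suc (length u) ∸ posOf i u) (oneTo (length u))

-- Baxter: no 3-14-2 and no 2-41-3 occurrence (0-based positions i < j < j+1 < k)
Baxter : List ℕ → Set
Baxter w = ∀ i j k → i < j → suc j < k → k < length w →
  ¬ (at w j < at w k × at w k < at w i × at w i < at w (suc j)) ×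
  ¬ (at w (suc j) < at w i × at w i < at w k × at w k < at w j)

SmallerLeftOf : List ℕ → ℕ → Set
SmallerLeftOf w v = ∀ a b → a < length w → b < length w → at w a < v → at w b ≡ v → a < b

LargerLeftOf : List ℕ → ℕ → Set
LargerLeftOf w v = ∀ a b → a < length w → b < length w → v < at w a → at w b ≡ v → a < b

SmallerRightOf : List ℕ → ℕ → Set
SmallerRightOf w v = ∀ a b → a < length w → b < length w → at w a < v → at w b ≡ v → b < a

LargerRightOf : List ℕ → ℕ → Set
LargerRightOf w v = ∀ a b → a < length w → b < length w → v < at w a → at w b ≡ v → b < a

module Submission where

-- The rotations are defined through positions (posOf),
-- inserting the new maximum at index t moves every later position one step back, and through a
-- rotation this becomes exactly the shift of the values ≥ j that app and pre perform on w.
--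
-- Shifting preserves relative order, so an occurrence of 3-14-2 or 2-41-3 in app j w either avoids
-- the last entry, and then already occurs in w, or ends at the appended j, and then it is an entry
-- of w followed by an adjacent pair that straddles the threshold j (LastOcc). If every entry smaller
-- than j lies left of j, or every entry larger than j - 1 lies left of j - 1, then the entry j,
-- resp. j - 1, completes such a configuration to a forbidden pattern already in w. Conversely, if j
-- comes before j - 1 in w, an entry larger than j - 1 to the right of j - 1 would be reached from
-- j - 1 by an adjacent ascent across j, which together with j and the appended entry is forbidden
-- in app j w; symmetrically when j - 1 comes before j. Finally reverse (pre j w) = app j (reverse w),
-- reversal preserves the Baxter property, and it exchanges "left of" and "right of".

open import Defs
open import Data.Bool using (true; false; if_then_else_; T)
open import Data.Empty using (⊥-elim)
open import Data.List using (List; []; _∷_; _++_; [_]; map; upTo; applyUpTo; length; take; drop; reverse)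
open import Data.List.Properties using (length-map; length-++; length-upTo; length-reverse; reverse-involutive; reverse-map; unfold-reverse)
open import Data.List.Membership.Propositional using (_∈_; _∉_)
open import Data.List.Membership.Propositional.Properties using (∈-map⁺; ∈-map⁻; ∈-upTo⁺; ∈-upTo⁻)
open import Data.List.Relation.Unary.Any using (here; there)
import Data.List.Relation.Unary.All as All
open import Data.List.Relation.Unary.Unique.Propositional using (Unique)
open import Data.List.Relation.Unary.AllPairs using (_∷_)
open import Data.List.Relation.Unary.Unique.Propositional.Properties using (map⁺; upTo⁺)
open import Data.List.Relation.Binary.Permutation.Propositional using (↭-sym; ↭-trans; ↭⇒↭ₛ)
open import Data.List.Relation.Binary.Permutation.Propositional.Properties using (∈-resp-↭; ↭-length; ↭-reverse)
import Data.List.Relation.Binary.Permutation.Setoid.Properties as ↭ₛ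
open import Data.Nat
open import Data.Nat.Properties
open import Data.Product using (_×_; _,_; proj₁; proj₂; ∃-syntax)
open import Data.Sum using (_⊎_; inj₁; inj₂)
open import Function.Bundles using (_⇔_; mk⇔; Equivalence)
open import Function.Construct.Composition using (_⇔-∘_)
open import Function.Construct.Identity using (⇔-id)
open import Function.Construct.Symmetry using (⇔-sym)
open import Data.Product.Function.NonDependent.Propositional using (_×-⇔_)
open import Data.Sum.Function.Propositional using (_⊎-⇔_)
open import Function using (_∘′_)
open import Relation.Binary.Definitions using (tri<; tri≈; tri>)
open import Relation.Binary.PropositionalEquality using (setoid; _≡_; _≢_; ≢-sym; refl; sym; trans; cong; cong₂; subst; subst₂; module ≡-Reasoning)
open import Relation.Nullary using (¬_; yes; no)
open import Relation.Unary using (Decidable)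

open ≡-Reasoning

at-map : ∀ (f : ℕ → ℕ) xs {i} → i < length xs → at (map f xs) i ≡ f (at xs i)
at-map f (x ∷ xs) {zero}  _         = refl
at-map f (x ∷ xs) {suc i} (s≤s i<) = at-map f xs i<

at-++ˡ : ∀ xs ys {i} → i < length xs → at (xs ++ ys) i ≡ at xs i
at-++ˡ (x ∷ xs) ys {zero}  _         = refl
at-++ˡ (x ∷ xs) ys {suc i} (s≤s i<) = at-++ˡ xs ys i<

at-++ʳ : ∀ xs ys i → at (xs ++ ys) (length xs + i) ≡ at ys i
at-++ʳ []       ys i = refl
at-++ʳ (x ∷ xs) ys i = at-++ʳ xs ys i

at-∈ : ∀ xs {i} → i < length xs → at xs i ∈ xs
at-∈ (x ∷ xs) {zero}  _         = here refl
at-∈ (x ∷ xs) {suc i} (s≤s i<) = there (at-∈ xs i<)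

∈⇒at : ∀ {x} xs → x ∈ xs → ∃[ i ] i < length xs × at xs i ≡ x
∈⇒at (y ∷ xs) (here refl) = 0 , s≤s z≤n , refl
∈⇒at (y ∷ xs) (there x∈) with ∈⇒at xs x∈
... | i , i< , eq = suc i , s≤s i< , eq

at-ext : ∀ xs ys → length xs ≡ length ys → (∀ i → i < length xs → at xs i ≡ at ys i) → xs ≡ ys
at-ext []       []       _  _  = refl
at-ext (x ∷ xs) (y ∷ ys) eq f =
  cong₂ _∷_ (f 0 (s≤s z≤n)) (at-ext xs ys (suc-injective eq) (λ i i< → f (suc i) (s≤s i<)))

at-applyUpTo : ∀ (f : ℕ → ℕ) n {i} → i < n → at (applyUpTo f n) i ≡ f i
at-applyUpTo f (suc n) {zero}  _         = refl
at-applyUpTo f (suc n) {suc i} (s≤s i<) = at-applyUpTo (f ∘′ suc) n i<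

length-oneTo : ∀ n → length (oneTo n) ≡ n
length-oneTo n = trans (length-map suc (upTo n)) (length-upTo n)

at-oneTo : ∀ n {i} → i < n → at (oneTo n) i ≡ suc i
at-oneTo n i< = trans (at-map suc (upTo n) (subst (_ <_) (sym (length-upTo n)) i<))
                      (cong suc (at-applyUpTo (λ k → k) n i<))

∈-oneTo⁻ : ∀ {n x} → x ∈ oneTo n → 1 ≤ x × x ≤ n
∈-oneTo⁻ x∈ with ∈-map⁻ suc x∈
... | y , y∈ , refl = s≤s z≤n , ∈-upTo⁻ y∈

∈-oneTo⁺ : ∀ {n x} → 1 ≤ x → x ≤ n → x ∈ oneTo n
∈-oneTo⁺ {x = suc y} _ y< = ∈-map⁺ suc (∈-upTo⁺ y<)

at-reverse : ∀ xs {i} → i < length xs → at (reverse xs) i ≡ at xs (length xs ∸ suc i)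
at-reverse []       ()
at-reverse (x ∷ xs) {i} i< rewrite unfold-reverse x xs with m≤n⇒m<n∨m≡n (≤-pred i<)
... | inj₁ i<xs = begin
  at (reverse xs ++ [ x ]) i       ≡⟨ at-++ˡ (reverse xs) [ x ] (subst (i <_) (sym (length-reverse xs)) i<xs) ⟩
  at (reverse xs) i                ≡⟨ at-reverse xs i<xs ⟩
  at xs (length xs ∸ suc i)        ≡⟨ cong (at (x ∷ xs)) (sym (+-∸-assoc 1 i<xs)) ⟩
  at (x ∷ xs) (length xs ∸ i)      ∎
... | inj₂ refl = begin
  at (reverse xs ++ [ x ]) (length xs)                ≡⟨ cong (at (reverse xs ++ [ x ])) (sym last≡) ⟩
  at (reverse xs ++ [ x ]) (length (reverse xs) + 0)  ≡⟨ at-++ʳ (reverse xs) [ x ] 0 ⟩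
  x                                                   ≡⟨ cong (at (x ∷ xs)) (sym (n∸n≡0 (length xs))) ⟩
  at (x ∷ xs) (length xs ∸ length xs)                 ∎
  where
  last≡ : length (reverse xs) + 0 ≡ length xs
  last≡ = trans (+-identityʳ _) (length-reverse xs)

-- Positions and insertion

posOf-here : ∀ {x y} ys → x ≡ y → posOf x (y ∷ ys) ≡ 1
posOf-here {x} {y} ys x≡y with x ≡ᵇ y | ≡⇒≡ᵇ x y x≡y
... | true | _ = refl

posOf-there : ∀ {x y} ys → x ≢ y → posOf x (y ∷ ys) ≡ suc (posOf x ys)
posOf-there {x} {y} ys x≢y with x ≡ᵇ y in eq
... | true  = ⊥-elim (x≢y (≡ᵇ⇒≡ x y (subst T (sym eq) _)))
... | false = refl

posOf-≤ : ∀ x xs → posOf x xs ≤ length xs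
posOf-≤ x []       = z≤n
posOf-≤ x (y ∷ ys) with x ≟ y
... | yes x≡y rewrite posOf-here ys x≡y = s≤s z≤n
... | no  x≢y rewrite posOf-there ys x≢y = s≤s (posOf-≤ x ys)

posOf-≥1 : ∀ x y ys → 1 ≤ posOf x (y ∷ ys)
posOf-≥1 x y ys with x ≟ y
... | yes x≡y rewrite posOf-here ys x≡y = s≤s z≤n
... | no  x≢y rewrite posOf-there ys x≢y = s≤s z≤n

posOf-unique : ∀ x xs {p} → p < length xs → at xs p ≡ x →
               (∀ {q} → q < length xs → at xs q ≡ x → q ≡ p) → posOf x xs ≡ suc p
posOf-unique x (y ∷ ys) {p} p< atp only with x ≟ y
... | yes x≡y rewrite posOf-here ys x≡y = cong suc (only (s≤s z≤n) (sym x≡y))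
posOf-unique x (y ∷ ys) {zero}  p<       atp only | no x≢y = ⊥-elim (x≢y (sym atp))
posOf-unique x (y ∷ ys) {suc p} (s≤s p<) atp only | no x≢y rewrite posOf-there ys x≢y =
  cong suc (posOf-unique x ys p< atp (λ q< atq → suc-injective (only (s≤s q<) atq)))

-- shift j is definitionally map (bump j).
bump : ℕ → ℕ → ℕ
bump j x = if j ≤ᵇ x then suc x else x

bump-≥ : ∀ {j x} → j ≤ x → bump j x ≡ suc x
bump-≥ {j} {x} j≤x with j ≤ᵇ x | ≤⇒≤ᵇ j≤x
... | true | _ = refl

bump-< : ∀ {j x} → x < j → bump j x ≡ x
bump-< {j} {x} x<j with j ≤ᵇ x in eq
... | true  = ⊥-elim (<⇒≱ x<j (≤ᵇ⇒≤ j x (subst T (sym eq) _)))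
... | false = refl

bump-suc : ∀ j x → bump (suc j) (suc x) ≡ suc (bump j x)
bump-suc j x with j ≤? x
... | yes j≤x = trans (bump-≥ (s≤s j≤x)) (cong suc (sym (bump-≥ j≤x)))
... | no  j≰x = trans (bump-< (s≤s (≰⇒> j≰x))) (cong suc (sym (bump-< (≰⇒> j≰x))))

bump-reflect : ∀ {m j v} → j ≤ m → v ≤ m → suc m ∸ bump (m ∸ j) (m ∸ v) ≡ bump (suc j) v
bump-reflect {m} {j} {v} j≤m v≤m with suc j ≤? v
... | yes j<v = begin
  suc m ∸ bump (m ∸ j) (m ∸ v)  ≡⟨ cong (suc m ∸_) (bump-< (∸-monoʳ-< j<v v≤m)) ⟩
  suc m ∸ (m ∸ v)               ≡⟨ +-∸-assoc 1 (m∸n≤m m v) ⟩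
  suc (m ∸ (m ∸ v))             ≡⟨ cong suc (m∸[m∸n]≡n v≤m) ⟩
  suc v                         ≡⟨ sym (bump-≥ j<v) ⟩
  bump (suc j) v                ∎
... | no j≮v = begin
  suc m ∸ bump (m ∸ j) (m ∸ v)  ≡⟨ cong (suc m ∸_) (bump-≥ (∸-monoʳ-≤ m (≤-pred (≰⇒> j≮v)))) ⟩
  m ∸ (m ∸ v)                   ≡⟨ m∸[m∸n]≡n v≤m ⟩
  v                             ≡⟨ sym (bump-< (≰⇒> j≮v)) ⟩
  bump (suc j) v                ∎

bump-cancel-< : ∀ j {x y} → bump j x < bump j y → x < y
bump-cancel-< j {x} {y} lt with j ≤? x | j ≤? y
... | yes j≤x | yes j≤y = ≤-pred (subst₂ _<_ (bump-≥ j≤x) (bump-≥ j≤y) lt)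
... | yes j≤x | no  j≰y =
  ⊥-elim (<-asym (subst₂ _<_ (bump-≥ j≤x) (bump-< (≰⇒> j≰y)) lt) (<-≤-trans (≰⇒> j≰y) (m≤n⇒m≤1+n j≤x)))
... | no  j≰x | yes j≤y = <-≤-trans (≰⇒> j≰x) j≤y
... | no  j≰x | no  j≰y = subst₂ _<_ (bump-< (≰⇒> j≰x)) (bump-< (≰⇒> j≰y)) lt

bump-mono-< : ∀ j {x y} → x < y → bump j x < bump j y
bump-mono-< j {x} {y} lt with j ≤? x | j ≤? y
... | yes j≤x | yes j≤y = subst₂ _<_ (sym (bump-≥ j≤x)) (sym (bump-≥ j≤y)) (s≤s lt)
... | yes j≤x | no  j≰y = ⊥-elim (<-asym lt (<-≤-trans (≰⇒> j≰y) j≤x))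
... | no  j≰x | yes j≤y = subst₂ _<_ (sym (bump-< (≰⇒> j≰x))) (sym (bump-≥ j≤y)) (m≤n⇒m≤1+n lt)
... | no  j≰x | no  j≰y = subst₂ _<_ (sym (bump-< (≰⇒> j≰x))) (sym (bump-< (≰⇒> j≰y))) lt

bump<⇔ : ∀ j x → bump j x < j ⇔ x < j
bump<⇔ j x with j ≤? x
... | yes j≤x = mk⇔ (λ lt → ⊥-elim (<-asym (subst (_< j) (bump-≥ j≤x) lt) (s≤s j≤x)))
                    (λ x<j → ⊥-elim (<⇒≱ x<j j≤x))
... | no  j≰x = mk⇔ (subst (_< j) (bump-< (≰⇒> j≰x))) (subst (_< j) (sym (bump-< (≰⇒> j≰x))))

<bump⇔ : ∀ j x → j < bump j x ⇔ j ≤ x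
<bump⇔ j x with j ≤? x
... | yes j≤x = mk⇔ (λ _ → j≤x) (λ _ → subst (j <_) (sym (bump-≥ j≤x)) (s≤s j≤x))
... | no  j≰x = mk⇔ (λ lt → ⊥-elim (j≰x (<⇒≤ (subst (j <_) (bump-< (≰⇒> j≰x)) lt))))
                    (λ j≤x → ⊥-elim (j≰x j≤x))

insert : ℕ → ℕ → List ℕ → List ℕ
insert t x u = take t u ++ (x ∷ drop t u)

length-insert : ∀ t x u → length (insert t x u) ≡ suc (length u)
length-insert zero    x u        = refl
length-insert (suc t) x []       = refl
length-insert (suc t) x (y ∷ u) = cong suc (length-insert t x u)

posOf-insert-new : ∀ t x u → x ∉ u → t ≤ length u → posOf x (insert t x u) ≡ suc t
posOf-insert-new zero    x u       _   _        = posOf-here u refl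
posOf-insert-new (suc t) x (y ∷ u) x∉ (s≤s t≤) =
  trans (posOf-there (insert t x u) (λ x≡y → x∉ (here x≡y)))
        (cong suc (posOf-insert-new t x u (λ x∈ → x∉ (there x∈)) t≤))

-- Positions are 1-based, so the entries pushed back are those at position ≥ t + 1.
posOf-insert : ∀ t x u {y} → y ≢ x → y ∈ u → posOf y (insert t x u) ≡ bump (suc t) (posOf y u)
posOf-insert zero x (z ∷ u) {y} y≢x _ = begin
  posOf y (x ∷ z ∷ u)        ≡⟨ posOf-there (z ∷ u) y≢x ⟩
  suc (posOf y (z ∷ u))      ≡⟨ sym (bump-≥ (posOf-≥1 y z u)) ⟩
  bump 1 (posOf y (z ∷ u))   ∎
posOf-insert (suc t) x (z ∷ u) {y} y≢x y∈ with y ≟ z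
... | yes y≡z rewrite posOf-here (insert t x u) y≡z | posOf-here u y≡z =
  sym (bump-< {suc (suc t)} (s≤s (s≤s z≤n)))
posOf-insert (suc t) x (z ∷ u) {y} y≢x (here y≡z) | no y≢z = ⊥-elim (y≢z y≡z)
posOf-insert (suc t) x (z ∷ u) {y} y≢x (there y∈) | no y≢z
  rewrite posOf-there (insert t x u) y≢z | posOf-there u y≢z =
  trans (cong suc (posOf-insert t x u y≢x y∈)) (sym (bump-suc (suc t) (posOf y u)))

-- Rotations

length-Rcw : ∀ u → length (Rcw u) ≡ length u
length-Rcw u = trans (length-map _ (oneTo (length u))) (length-oneTo (length u))

length-Rccw : ∀ u → length (Rccw u) ≡ length u
length-Rccw u = trans (length-map _ (oneTo (length u))) (length-oneTo (length u))

at-Rcw : ∀ {m} u → length u ≡ m → ∀ {q} → q < m → at (Rcw u) q ≡ posOf (m ∸ q) u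
at-Rcw u refl {q} q< = trans (at-map _ (oneTo (length u)) (subst (q <_) (sym (length-oneTo _)) q<))
                             (cong (λ i → posOf (suc (length u) ∸ i) u) (at-oneTo (length u) q<))

at-Rccw : ∀ {m} u → length u ≡ m → ∀ {q} → q < m → at (Rccw u) q ≡ suc m ∸ posOf (suc q) u
at-Rccw u refl {q} q< = trans (at-map _ (oneTo (length u)) (subst (q <_) (sym (length-oneTo _)) q<))
                              (cong (λ i → suc (length u) ∸ posOf i u) (at-oneTo (length u) q<))

length∉Rcw : ∀ u → suc (length u) ∉ Rcw u
length∉Rcw u x∈ with ∈-map⁻ _ x∈
... | i , _ , eq = <-irrefl (sym eq) (s≤s (posOf-≤ _ u))

length∉Rccw : ∀ u → suc (length u) ∉ Rccw u
length∉Rccw []      ()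
length∉Rccw (y ∷ u) x∈
  with ∈-map⁻ (λ i → suc (length (y ∷ u)) ∸ posOf i (y ∷ u)) {xs = oneTo (length (y ∷ u))} x∈
... | i , _ , eq = <-irrefl (sym eq) (s≤s (∸-monoʳ-≤ (suc (length (y ∷ u))) (posOf-≥1 i y u)))

Unique⇒at-injective : ∀ {xs} → Unique xs → ∀ {i k} → i < length xs → k < length xs →
                      at xs i ≡ at xs k → i ≡ k
Unique⇒at-injective {x ∷ xs} _        {zero}  {zero}  _        _        _  = refl
Unique⇒at-injective {x ∷ xs} (x∉ ∷ _) {zero}  {suc k} _        (s≤s k<) eq = ⊥-elim (All.lookup x∉ (at-∈ xs k<) eq)
Unique⇒at-injective {x ∷ xs} (x∉ ∷ _) {suc i} {zero}  (s≤s i<) _        eq = ⊥-elim (All.lookup x∉ (at-∈ xs i<) (sym eq))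
Unique⇒at-injective {x ∷ xs} (_ ∷ u)  {suc i} {suc k} (s≤s i<) (s≤s k<) eq = cong suc (Unique⇒at-injective u i< k< eq)

record Perm (m : ℕ) (w : List ℕ) : Set where
  field
    length≡       : length w ≡ m
    at-≥1         : ∀ {c} → c < m → 1 ≤ at w c
    at-≤          : ∀ {c} → c < m → at w c ≤ m
    at-injective  : ∀ {c d} → c < m → d < m → at w c ≡ at w d → c ≡ d
    at-surjective : ∀ {v} → 1 ≤ v → v ≤ m → ∃[ c ] c < m × at w c ≡ v

isPerm⇒perm : ∀ {m w} → IsPerm m w → Perm m w
isPerm⇒perm {m} {w} w↭ = record
  { length≡       = length≡
  ; at-≥1         = λ c< → proj₁ (range c<)
  ; at-≤          = λ c< → proj₂ (range c<)
  ; at-injective  = λ c< d< → Unique⇒at-injective unique (<-length c<) (<-length d<)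
  ; at-surjective = surjective
  }
  where
  length≡ : length w ≡ m
  length≡ = trans (↭-length w↭) (length-oneTo m)
  <-length : ∀ {c} → c < m → c < length w
  <-length = subst (_ <_) (sym length≡)
  range : ∀ {c} → c < m → 1 ≤ at w c × at w c ≤ m
  range c< = ∈-oneTo⁻ (∈-resp-↭ w↭ (at-∈ w (<-length c<)))
  unique : Unique w
  unique = ↭ₛ.Unique-resp-↭ (setoid ℕ) (↭⇒↭ₛ (↭-sym w↭)) (map⁺ suc-injective (upTo⁺ m))
  surjective : ∀ {v} → 1 ≤ v → v ≤ m → ∃[ c ] c < m × at w c ≡ v
  surjective 1≤v v≤m with ∈⇒at w (∈-resp-↭ (↭-sym w↭) (∈-oneTo⁺ 1≤v v≤m))
  ... | c , c< , eq = c , subst (c <_) length≡ c< , eq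

-- Baxter patterns

Occ3142 Occ2413 : List ℕ → ℕ → ℕ → ℕ → Set
Occ3142 w i j k = at w j < at w k × at w k < at w i × at w i < at w (suc j)
Occ2413 w i j k = at w (suc j) < at w i × at w i < at w k × at w k < at w j

-- What an occurrence in app j w ending at the appended entry j looks like in w.
LastOcc3142 LastOcc2413 : List ℕ → ℕ → ℕ → ℕ → Set
LastOcc3142 w j i p = at w p < j × j ≤ at w i × at w i < at w (suc p)
LastOcc2413 w j i p = at w (suc p) < at w i × at w i < j × j ≤ at w p

AppCondition PreCondition : ℕ → List ℕ → ℕ → Set
AppCondition m w j = (j ≤ m × SmallerLeftOf w j) ⊎ (2 ≤ j × LargerLeftOf w (j ∸ 1))
PreCondition m w j = (j ≤ m × SmallerRightOf w j) ⊎ (2 ≤ j × LargerRightOf w (j ∸ 1))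

crossing-point : ∀ {Q : ℕ → Set} → Decidable Q → ∀ {d a} → d < a → Q d → ¬ Q a →
                 ∃[ p ] d ≤ p × p < a × Q p × ¬ Q (suc p)
crossing-point Q? {d} {suc a} d<a Qd ¬Qa with Q? a
... | yes Qa = a , ≤-pred d<a , ≤-refl , Qa , ¬Qa
... | no ¬Qa′ with m≤n⇒m<n∨m≡n (≤-pred d<a)
...   | inj₂ refl = ⊥-elim (¬Qa′ Qd)
...   | inj₁ d<a′ with crossing-point Q? d<a′ Qd ¬Qa′
...     | p , d≤p , p<a , Qp , ¬Qp+1 = p , d≤p , m≤n⇒m≤1+n p<a , Qp , ¬Qp+1

-- Reversal

reverse-pre : ∀ j w → reverse (pre j w) ≡ app j (reverse w)
reverse-pre j w = begin
  reverse (j ∷ shift j w)       ≡⟨ unfold-reverse j (shift j w) ⟩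
  reverse (shift j w) ++ [ j ]  ≡⟨ cong (_++ [ j ]) (sym (reverse-map (bump j) w)) ⟩
  shift j (reverse w) ++ [ j ]  ∎

suc[n∸suc[i]]≡n∸i : ∀ {n i} → i < n → suc (n ∸ suc i) ≡ n ∸ i
suc[n∸suc[i]]≡n∸i i<n = sym (+-∸-assoc 1 i<n)

n∸1+b<n∸1+a⇒a<b : ∀ n {a b} → n ∸ suc b < n ∸ suc a → a < b
n∸1+b<n∸1+a⇒a<b n lt = ≰⇒> (λ b≤a → <⇒≱ lt (∸-monoʳ-≤ n (s≤s b≤a)))

-- Reading w backwards swaps the patterns 3-14-2 and 2-41-3.
Baxter-reverse : ∀ w → Baxter w → Baxter (reverse w)
Baxter-reverse w B i j k i<j j+1<k k<
  with k<n ← subst (k <_) (length-reverse w) k<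
  = (λ (h₁ , h₂ , h₃) → proj₂ (B i′ j′ k′ i′<j′ j′+1<k′ k′<n)
                           (subst₂ _<_ rⱼ rₖ h₁ , subst₂ _<_ rₖ rᵢ h₂ , subst₂ _<_ rᵢ rⱼ₊₁ h₃))
  , (λ (h₁ , h₂ , h₃) → proj₁ (B i′ j′ k′ i′<j′ j′+1<k′ k′<n)
                           (subst₂ _<_ rⱼ₊₁ rᵢ h₁ , subst₂ _<_ rᵢ rₖ h₂ , subst₂ _<_ rₖ rⱼ h₃))
  where
  n = length w
  i′ = n ∸ suc k
  j′ = n ∸ suc (suc j)
  k′ = n ∸ suc i
  j+1<n = <-trans j+1<k k<n
  j<n = <-trans (n<1+n j) j+1<n
  i<n = <-trans i<j j<n
  i′<j′ = ∸-monoʳ-< (s≤s j+1<k) k<n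
  j′+1<k′ = subst (_< k′) (sym (suc[n∸suc[i]]≡n∸i j+1<n)) (∸-monoʳ-< (s≤s i<j) j<n)
  k′<n = ∸-monoʳ-< {o = 0} (s≤s z≤n) i<n
  r≡ : ∀ {x} → x < n → at (reverse w) x ≡ at w (n ∸ suc x)
  r≡ x< = at-reverse w x<
  rᵢ = r≡ i<n
  rⱼ = trans (r≡ j<n) (cong (at w) (sym (suc[n∸suc[i]]≡n∸i j+1<n)))
  rⱼ₊₁ = r≡ j+1<n
  rₖ = r≡ k<n

Baxter⇔Baxter-reverse : ∀ w → Baxter w ⇔ Baxter (reverse w)
Baxter⇔Baxter-reverse w = mk⇔ (Baxter-reverse w)
  (λ B → subst Baxter (reverse-involutive w) (Baxter-reverse (reverse w) B))

EntriesLeftOf EntriesRightOf : (ℕ → Set) → List ℕ → ℕ → Set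
EntriesLeftOf  Q w v = ∀ a b → a < length w → b < length w → Q (at w a) → at w b ≡ v → a < b
EntriesRightOf Q w v = ∀ a b → a < length w → b < length w → Q (at w a) → at w b ≡ v → b < a

module _ (Q : ℕ → Set) (w : List ℕ) (v : ℕ) where
  private
    n = length w
    <n : ∀ {a} → a < length (reverse w) → a < n
    <n = subst (_ <_) (length-reverse w)
    ∸<n : ∀ {a} → a < length (reverse w) → n ∸ suc a < n
    ∸<n a< = ∸-monoʳ-< {o = 0} (s≤s z≤n) (<n a<)

  EntriesRightOf⇒EntriesLeftOf-reverse : EntriesRightOf Q w v → EntriesLeftOf Q (reverse w) v
  EntriesRightOf⇒EntriesLeftOf-reverse R a b a< b< Qa at≡ = n∸1+b<n∸1+a⇒a<b n
    (R (n ∸ suc a) (n ∸ suc b) (∸<n a<) (∸<n b<)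
       (subst Q (at-reverse w (<n a<)) Qa) (trans (sym (at-reverse w (<n b<))) at≡))

  EntriesLeftOf⇒EntriesRightOf-reverse : EntriesLeftOf Q w v → EntriesRightOf Q (reverse w) v
  EntriesLeftOf⇒EntriesRightOf-reverse L a b a< b< Qa at≡ = n∸1+b<n∸1+a⇒a<b n
    (L (n ∸ suc a) (n ∸ suc b) (∸<n a<) (∸<n b<)
       (subst Q (at-reverse w (<n a<)) Qa) (trans (sym (at-reverse w (<n b<))) at≡))

EntriesRightOf⇔EntriesLeftOf-reverse : ∀ Q w v → EntriesRightOf Q w v ⇔ EntriesLeftOf Q (reverse w) v
EntriesRightOf⇔EntriesLeftOf-reverse Q w v = mk⇔ (EntriesRightOf⇒EntriesLeftOf-reverse Q w v)
  (λ L → subst (λ u → EntriesRightOf Q u v) (reverse-involutive w)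
                (EntriesLeftOf⇒EntriesRightOf-reverse Q (reverse w) v L))

module _ {m w} (P : Perm m w) where
  open Perm P
  open Equivalence using (to; from)

  <-length : ∀ {c} → c < m → c < length w
  <-length = subst (_ <_) (sym length≡)

  posOf-at : ∀ {c} → c < m → posOf (at w c) w ≡ suc c
  posOf-at {c} c< = posOf-unique (at w c) w (<-length c<) refl
    (λ q< eq → at-injective (subst (_ <_) length≡ q<) c< eq)

  length-Rcw≡ : length (Rcw w) ≡ m
  length-Rcw≡ = trans (length-Rcw w) length≡

  length-Rccw≡ : length (Rccw w) ≡ m
  length-Rccw≡ = trans (length-Rccw w) length≡

  at-Rcw-reflected : ∀ {c} → c < m → at (Rcw w) (m ∸ at w c) ≡ suc c
  at-Rcw-reflected {c} c< = begin
    at (Rcw w) (m ∸ at w c)     ≡⟨ at-Rcw w length≡ (∸-monoʳ-< (at-≥1 c<) (at-≤ c<)) ⟩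
    posOf (m ∸ (m ∸ at w c)) w  ≡⟨ cong (λ v → posOf v w) (m∸[m∸n]≡n (at-≤ c<)) ⟩
    posOf (at w c) w            ≡⟨ posOf-at c< ⟩
    suc c                       ∎

  suc∈Rcw : ∀ {c} → c < m → suc c ∈ Rcw w
  suc∈Rcw {c} c< = subst (_∈ Rcw w) (at-Rcw-reflected c<)
    (at-∈ (Rcw w) (subst (m ∸ at w c <_) (sym length-Rcw≡) (∸-monoʳ-< (at-≥1 c<) (at-≤ c<))))

  posOf-Rcw : ∀ {c} → c < m → posOf (suc c) (Rcw w) ≡ suc (m ∸ at w c)
  posOf-Rcw {c} c< = posOf-unique (suc c) (Rcw w)
    (subst (m ∸ at w c <_) (sym length-Rcw≡) (∸-monoʳ-< (at-≥1 c<) (at-≤ c<))) (at-Rcw-reflected c<) only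
    where
    only : ∀ {q} → q < length (Rcw w) → at (Rcw w) q ≡ suc c → q ≡ m ∸ at w c
    only {q} q< eq with q<m ← subst (q <_) length-Rcw≡ q<
                   with at-surjective (m<n⇒0<n∸m q<m) (m∸n≤m m q)
    ... | c′ , c′< , at≡ with refl ← suc-injective (trans (sym (posOf-at c′<))
                                      (trans (cong (λ v → posOf v w) at≡) (trans (sym (at-Rcw w length≡ q<m)) eq)))
      = trans (sym (m∸[m∸n]≡n (<⇒≤ q<m))) (cong (m ∸_) (sym at≡))

  at-Rccw-pred : ∀ {c p} → c < m → at w c ≡ suc p → at (Rccw w) p ≡ m ∸ c
  at-Rccw-pred {c} {p} c< at≡ = begin
    at (Rccw w) p               ≡⟨ at-Rccw w length≡ (subst (_≤ m) at≡ (at-≤ c<)) ⟩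
    suc m ∸ posOf (suc p) w     ≡⟨ cong (λ v → suc m ∸ posOf v w) (sym at≡) ⟩
    suc m ∸ posOf (at w c) w    ≡⟨ cong (suc m ∸_) (posOf-at c<) ⟩
    m ∸ c                       ∎

  m∸c∈Rccw : ∀ {c} → c < m → m ∸ c ∈ Rccw w
  m∸c∈Rccw {c} c< with at w c in at≡ | at-≥1 c<
  ... | suc p | _ = subst (_∈ Rccw w) (at-Rccw-pred c< at≡)
    (at-∈ (Rccw w) (subst (p <_) (sym length-Rccw≡) (subst (_≤ m) at≡ (at-≤ c<))))

  posOf-Rccw : ∀ {c} → c < m → posOf (m ∸ c) (Rccw w) ≡ at w c
  posOf-Rccw {c} c< with at w c in at≡ | at-≥1 c<
  ... | suc p | _ = posOf-unique (m ∸ c) (Rccw w)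
    (subst (p <_) (sym length-Rccw≡) (subst (_≤ m) at≡ (at-≤ c<))) (at-Rccw-pred c< at≡) only
    where
    only : ∀ {q} → q < length (Rccw w) → at (Rccw w) q ≡ m ∸ c → q ≡ p
    only {q} q< eq with q<m ← subst (q <_) length-Rccw≡ q<
                   with at-surjective (s≤s z≤n) q<m
    ... | c′ , c′< , at′≡ with refl ← ∸-cancelˡ-≡ (<⇒≤ c′<) (<⇒≤ c<) (begin
            m ∸ c′                     ≡⟨ cong (suc m ∸_) (sym (posOf-at c′<)) ⟩
            suc m ∸ posOf (at w c′) w  ≡⟨ cong (λ v → suc m ∸ posOf v w) at′≡ ⟩
            suc m ∸ posOf (suc q) w    ≡⟨ sym (at-Rccw w length≡ q<m) ⟩
            at (Rccw w) q              ≡⟨ eq ⟩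
            m ∸ c                      ∎)
      = suc-injective (trans (sym at′≡) at≡)

  posOf-insert-Rcw : ∀ t {c} → c < m → posOf (suc c) (insert t (suc m) (Rcw w)) ≡ suc (bump t (m ∸ at w c))
  posOf-insert-Rcw t {c} c< = begin
    posOf (suc c) (insert t (suc m) (Rcw w))  ≡⟨ posOf-insert t (suc m) (Rcw w)
                                                   (λ eq → <-irrefl (suc-injective eq) c<) (suc∈Rcw c<) ⟩
    bump (suc t) (posOf (suc c) (Rcw w))      ≡⟨ cong (bump (suc t)) (posOf-Rcw c<) ⟩
    bump (suc t) (suc (m ∸ at w c))           ≡⟨ bump-suc t (m ∸ at w c) ⟩
    suc (bump t (m ∸ at w c))                 ∎

  posOf-insert-Rccw : ∀ t {c} → c < m → posOf (m ∸ c) (insert t (suc m) (Rccw w)) ≡ bump (suc t) (at w c)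
  posOf-insert-Rccw t {c} c< = begin
    posOf (m ∸ c) (insert t (suc m) (Rccw w))  ≡⟨ posOf-insert t (suc m) (Rccw w)
                                                    (λ eq → <-irrefl eq (s≤s (m∸n≤m m c))) (m∸c∈Rccw c<) ⟩
    bump (suc t) (posOf (m ∸ c) (Rccw w))      ≡⟨ cong (bump (suc t)) (posOf-Rccw c<) ⟩
    bump (suc t) (at w c)                      ∎

  length-app : ∀ j → length (app j w) ≡ suc m
  length-app j = begin
    length (shift j w ++ [ j ])  ≡⟨ length-++ (shift j w) ⟩
    length (shift j w) + 1       ≡⟨ cong (_+ 1) (trans (length-map _ w) length≡) ⟩
    m + 1                        ≡⟨ +-comm m 1 ⟩
    suc m                        ∎

  at-app-init : ∀ j {c} → c < m → at (app j w) c ≡ bump j (at w c)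
  at-app-init j c< = trans (at-++ˡ (shift j w) [ j ] (subst (_ <_) (sym (length-map _ w)) (<-length c<)))
                           (at-map (bump j) w (<-length c<))

  at-app-last : ∀ j → at (app j w) m ≡ j
  at-app-last j = subst (λ i → at (app j w) i ≡ j) (trans (+-identityʳ _) (trans (length-map _ w) length≡))
                        (at-++ʳ (shift j w) [ j ] 0)

  app≡Rccw-insMax-Rcw : ∀ {j} → 1 ≤ j → j ≤ suc m → app j w ≡ Rccw (insMax (Rcw w) (suc m + 1 ∸ j))
  app≡Rccw-insMax-Rcw {suc j} _ (s≤s j≤m) = begin
    app (suc j) w                              ≡⟨ at-ext _ _ (trans (length-app _) (sym length-Rccw-u′)) entries ⟩
    Rccw u′                                    ≡⟨ cong Rccw (sym insMax≡) ⟩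
    Rccw (insMax (Rcw w) (suc m + 1 ∸ suc j))  ∎
    where
    u′ = insert (m ∸ j) (suc m) (Rcw w)
    length-u′ : length u′ ≡ suc m
    length-u′ = trans (length-insert (m ∸ j) (suc m) (Rcw w)) (cong suc length-Rcw≡)
    length-Rccw-u′ : length (Rccw u′) ≡ suc m
    length-Rccw-u′ = trans (length-Rccw u′) length-u′
    insMax≡ : insMax (Rcw w) (suc m + 1 ∸ suc j) ≡ u′
    insMax≡ = cong₂ (λ t L → insert t (suc L) (Rcw w)) index length-Rcw≡
      where
      index : m + 1 ∸ j ∸ 1 ≡ m ∸ j
      index = trans (∸-+-assoc (m + 1) j 1) (cong₂ _∸_ (+-comm m 1) (+-comm j 1))
    entries : ∀ c → c < length (app (suc j) w) → at (app (suc j) w) c ≡ at (Rccw u′) c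
    entries c c< with m≤n⇒m<n∨m≡n (≤-pred (subst (c <_) (length-app _) c<))
    ... | inj₁ c<m = begin
      at (app (suc j) w) c                ≡⟨ at-app-init (suc j) c<m ⟩
      bump (suc j) (at w c)               ≡⟨ sym (bump-reflect j≤m (at-≤ c<m)) ⟩
      suc m ∸ bump (m ∸ j) (m ∸ at w c)   ≡⟨ cong (suc (suc m) ∸_) (sym (posOf-insert-Rcw (m ∸ j) c<m)) ⟩
      suc (suc m) ∸ posOf (suc c) u′      ≡⟨ sym (at-Rccw u′ length-u′ (m≤n⇒m≤1+n c<m)) ⟩
      at (Rccw u′) c                      ∎
    ... | inj₂ refl = begin
      at (app (suc j) w) m            ≡⟨ at-app-last (suc j) ⟩
      suc j                           ≡⟨ sym (m∸[m∸n]≡n (s≤s j≤m)) ⟩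
      suc m ∸ (m ∸ j)                 ≡⟨ cong (suc (suc m) ∸_) (sym (posOf-insert-new (m ∸ j) (suc m) (Rcw w)
                                           (subst (λ L → suc L ∉ Rcw w) length≡ (length∉Rcw w))
                                           (subst (m ∸ j ≤_) (sym length-Rcw≡) (m∸n≤m m j)))) ⟩
      suc (suc m) ∸ posOf (suc m) u′  ≡⟨ sym (at-Rccw u′ length-u′ ≤-refl) ⟩
      at (Rccw u′) m                  ∎

  pre≡Rcw-insMax-Rccw : ∀ {j} → 1 ≤ j → j ≤ suc m → pre j w ≡ Rcw (insMax (Rccw w) j)
  pre≡Rcw-insMax-Rccw {suc t} _ (s≤s t≤m) = begin
    pre (suc t) w                  ≡⟨ at-ext _ _ (trans (cong suc length-shift) (sym length-Rcw-u′)) entries ⟩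
    Rcw u′                         ≡⟨ cong Rcw (sym insMax≡) ⟩
    Rcw (insMax (Rccw w) (suc t))  ∎
    where
    u′ = insert t (suc m) (Rccw w)
    length-shift : length (shift (suc t) w) ≡ m
    length-shift = trans (length-map _ w) length≡
    length-u′ : length u′ ≡ suc m
    length-u′ = trans (length-insert t (suc m) (Rccw w)) (cong suc length-Rccw≡)
    length-Rcw-u′ : length (Rcw u′) ≡ suc m
    length-Rcw-u′ = trans (length-Rcw u′) length-u′
    insMax≡ : insMax (Rccw w) (suc t) ≡ u′
    insMax≡ = cong (λ L → insert t (suc L) (Rccw w)) length-Rccw≡
    entries : ∀ c → c < length (pre (suc t) w) → at (pre (suc t) w) c ≡ at (Rcw u′) c
    entries zero _ = begin
      suc t             ≡⟨ sym (posOf-insert-new t (suc m) (Rccw w)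
                             (subst (λ L → suc L ∉ Rccw w) length≡ (length∉Rccw w))
                             (subst (t ≤_) (sym length-Rccw≡) t≤m)) ⟩
      posOf (suc m) u′  ≡⟨ sym (at-Rcw u′ length-u′ (s≤s z≤n)) ⟩
      at (Rcw u′) 0     ∎
    entries (suc c) (s≤s c<) with c<m ← subst (c <_) length-shift c< = begin
      at (pre (suc t) w) (suc c)             ≡⟨ at-map (bump (suc t)) w (<-length c<m) ⟩
      bump (suc t) (at w c)                  ≡⟨ sym (posOf-insert-Rccw t c<m) ⟩
      posOf (m ∸ c) u′                       ≡⟨ sym (at-Rcw u′ length-u′ (s≤s c<m)) ⟩
      at (Rcw u′) (suc c)                    ∎

  ≢⇒at≢ : ∀ {b x v} → b < m → x < m → at w b ≡ v → x ≢ b → at w x ≢ v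
  ≢⇒at≢ b< x< at≡ x≢b eq = x≢b (at-injective x< b< (trans eq (sym at≡)))

  NoLastOcc : ℕ → Set
  NoLastOcc j = ∀ i p → i < p → suc p < m → ¬ LastOcc3142 w j i p × ¬ LastOcc2413 w j i p

  app-Occ3142-last : ∀ j {i p} → i < p → suc p < m → Occ3142 (app j w) i p m ⇔ LastOcc3142 w j i p
  app-Occ3142-last j {i} {p} i<p p+1<m = mk⇔
    (λ (h₁ , h₂ , h₃) → to (bump<⇔ j _) (subst₂ _<_ aₚ (at-app-last j) h₁)
                       , to (<bump⇔ j _) (subst₂ _<_ (at-app-last j) aᵢ h₂)
                       , bump-cancel-< j (subst₂ _<_ aᵢ aₚ₊₁ h₃))
    (λ (h₁ , h₂ , h₃) → subst₂ _<_ (sym aₚ) (sym (at-app-last j)) (from (bump<⇔ j _) h₁)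
                       , subst₂ _<_ (sym (at-app-last j)) (sym aᵢ) (from (<bump⇔ j _) h₂)
                       , subst₂ _<_ (sym aᵢ) (sym aₚ₊₁) (bump-mono-< j h₃))
    where
    aᵢ = at-app-init j (<-trans i<p (<-trans (n<1+n p) p+1<m))
    aₚ = at-app-init j (<-trans (n<1+n p) p+1<m)
    aₚ₊₁ = at-app-init j p+1<m

  app-Occ2413-last : ∀ j {i p} → i < p → suc p < m → Occ2413 (app j w) i p m ⇔ LastOcc2413 w j i p
  app-Occ2413-last j {i} {p} i<p p+1<m = mk⇔
    (λ (h₁ , h₂ , h₃) → bump-cancel-< j (subst₂ _<_ aₚ₊₁ aᵢ h₁)
                       , to (bump<⇔ j _) (subst₂ _<_ aᵢ (at-app-last j) h₂)
                       , to (<bump⇔ j _) (subst₂ _<_ (at-app-last j) aₚ h₃))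
    (λ (h₁ , h₂ , h₃) → subst₂ _<_ (sym aₚ₊₁) (sym aᵢ) (bump-mono-< j h₁)
                       , subst₂ _<_ (sym aᵢ) (sym (at-app-last j)) (from (bump<⇔ j _) h₂)
                       , subst₂ _<_ (sym (at-app-last j)) (sym aₚ) (from (<bump⇔ j _) h₃))
    where
    aᵢ = at-app-init j (<-trans i<p (<-trans (n<1+n p) p+1<m))
    aₚ = at-app-init j (<-trans (n<1+n p) p+1<m)
    aₚ₊₁ = at-app-init j p+1<m

  Baxter-app⇔NoLastOcc : ∀ {j} → Baxter w → Baxter (app j w) ⇔ NoLastOcc j
  Baxter-app⇔NoLastOcc {j} B = mk⇔ forward backward
    where
    forward : Baxter (app j w) → NoLastOcc j
    forward BA i p i<p p+1<m =
        (λ occ → proj₁ (BA i p m i<p p+1<m m<) (from (app-Occ3142-last j i<p p+1<m) occ))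
      , (λ occ → proj₂ (BA i p m i<p p+1<m m<) (from (app-Occ2413-last j i<p p+1<m) occ))
      where
      m< : m < length (app j w)
      m< = subst (m <_) (sym (length-app j)) ≤-refl
    app-reflects-< : ∀ {x y} → x < m → y < m → at (app j w) x < at (app j w) y → at w x < at w y
    app-reflects-< x< y< lt = bump-cancel-< j (subst₂ _<_ (at-app-init j x<) (at-app-init j y<) lt)
    backward : NoLastOcc j → Baxter (app j w)
    backward NLO i p k i<p p+1<k k< with m≤n⇒m<n∨m≡n (≤-pred (subst (k <_) (length-app j) k<))
    ... | inj₁ k<m =
        (λ (h₁ , h₂ , h₃) → proj₁ (B i p k i<p p+1<k (<-length k<m))
                              (app-reflects-< p<m k<m h₁ , app-reflects-< k<m i<m h₂ , app-reflects-< i<m p+1<m h₃))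
      , (λ (h₁ , h₂ , h₃) → proj₂ (B i p k i<p p+1<k (<-length k<m))
                              (app-reflects-< p+1<m i<m h₁ , app-reflects-< i<m k<m h₂ , app-reflects-< k<m p<m h₃))
      where
      p+1<m = <-trans p+1<k k<m
      p<m = <-trans (n<1+n p) p+1<m
      i<m = <-trans i<p p<m
    ... | inj₂ refl =
        (λ occ → proj₁ (NLO i p i<p p+1<k) (to (app-Occ3142-last j i<p p+1<k) occ))
      , (λ occ → proj₂ (NLO i p i<p p+1<k) (to (app-Occ2413-last j i<p p+1<k) occ))

  SmallerLeftOf⇒NoLastOcc : ∀ {j} → Baxter w → 1 ≤ j → j ≤ m → SmallerLeftOf w j → NoLastOcc j
  SmallerLeftOf⇒NoLastOcc {j} B 1≤j j≤m SL i p i<p p+1<m with at-surjective 1≤j j≤m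
  ... | b , b<m , at≡j = no3142 , no2413
    where
    p<m = <-trans (n<1+n p) p+1<m
    i<m = <-trans i<p p<m
    no3142 : ¬ LastOcc3142 w j i p
    no3142 (wₚ<j , j≤wᵢ , wᵢ<wₚ₊₁) = proj₁ (B i p b i<p p+1<b (<-length b<m))
        (subst (at w p <_) (sym at≡j) wₚ<j , subst (_< at w i) (sym at≡j) j<wᵢ , wᵢ<wₚ₊₁)
      where
      p<b = SL p b (<-length p<m) (<-length b<m) wₚ<j at≡j
      j<wᵢ = ≤∧≢⇒< j≤wᵢ (≢-sym (≢⇒at≢ b<m i<m at≡j (<⇒≢ (<-trans i<p p<b))))
      p+1<b = ≤∧≢⇒< p<b (λ eq → <-irrefl (sym (trans (cong (at w) eq) at≡j)) (<-trans j<wᵢ wᵢ<wₚ₊₁))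
    no2413 : ¬ LastOcc2413 w j i p
    no2413 (wₚ₊₁<wᵢ , wᵢ<j , j≤wₚ) = proj₂ (B i p b i<p p+1<b (<-length b<m))
        (wₚ₊₁<wᵢ , subst (at w i <_) (sym at≡j) wᵢ<j , subst (_< at w p) (sym at≡j) j<wₚ)
      where
      p+1<b = SL (suc p) b (<-length p+1<m) (<-length b<m) (<-trans wₚ₊₁<wᵢ wᵢ<j) at≡j
      j<wₚ = ≤∧≢⇒< j≤wₚ (≢-sym (≢⇒at≢ b<m p<m at≡j (<⇒≢ (<-trans (n<1+n p) p+1<b))))

  LargerLeftOf⇒NoLastOcc : ∀ {j} → Baxter w → 1 ≤ j → j ≤ m → LargerLeftOf w j → NoLastOcc (suc j)
  LargerLeftOf⇒NoLastOcc {j} B 1≤j j≤m LL i p i<p p+1<m with at-surjective 1≤j j≤m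
  ... | d , d<m , at≡j = no3142 , no2413
    where
    p<m = <-trans (n<1+n p) p+1<m
    i<m = <-trans i<p p<m
    no3142 : ¬ LastOcc3142 w (suc j) i p
    no3142 (wₚ≤j , j<wᵢ , wᵢ<wₚ₊₁) = proj₁ (B i p d i<p p+1<d (<-length d<m))
        (subst (at w p <_) (sym at≡j) wₚ<j , subst (_< at w i) (sym at≡j) j<wᵢ , wᵢ<wₚ₊₁)
      where
      p+1<d = LL (suc p) d (<-length p+1<m) (<-length d<m) (<-trans j<wᵢ wᵢ<wₚ₊₁) at≡j
      wₚ<j = ≤∧≢⇒< (≤-pred wₚ≤j) (≢⇒at≢ d<m p<m at≡j (<⇒≢ (<-trans (n<1+n p) p+1<d)))
    no2413 : ¬ LastOcc2413 w (suc j) i p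
    no2413 (wₚ₊₁<wᵢ , wᵢ≤j , j<wₚ) = proj₂ (B i p d i<p p+1<d (<-length d<m))
        (wₚ₊₁<wᵢ , subst (at w i <_) (sym at≡j) wᵢ<j , subst (_< at w p) (sym at≡j) j<wₚ)
      where
      p<d = LL p d (<-length p<m) (<-length d<m) j<wₚ at≡j
      wᵢ<j = ≤∧≢⇒< (≤-pred wᵢ≤j) (≢⇒at≢ d<m i<m at≡j (<⇒≢ (<-trans i<p p<d)))
      p+1<d = ≤∧≢⇒< p<d (λ eq → <-irrefl (trans (cong (at w) eq) at≡j) (<-trans wₚ₊₁<wᵢ wᵢ<j))

  NoLastOcc⇒LargerLeftOf : ∀ {j b d} → b < d → d < m → at w b ≡ suc j → at w d ≡ j →
                           NoLastOcc (suc j) → LargerLeftOf w j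
  NoLastOcc⇒LargerLeftOf {j} {b} {d} b<d d<m at≡j+1 at≡j NLO a d′ a< d′< j<wₐ at≡j′
    with refl ← at-injective (subst (d′ <_) length≡ d′<) d<m (trans at≡j′ (sym at≡j))
    with <-cmp a d
  ... | tri< a<d _ _ = a<d
  ... | tri≈ _ refl _ = ⊥-elim (<-irrefl (sym at≡j′) j<wₐ)
  ... | tri> _ _ d<a with crossing-point (λ q → at w q <? suc j) d<a (s≤s (≤-reflexive at≡j)) (λ lt → <⇒≱ lt j<wₐ)
  ...   | p , d≤p , p<a , wₚ≤j , wₚ₊₁≰j =
    ⊥-elim (proj₁ (NLO b p b<p p+1<m) (wₚ≤j , ≤-reflexive (sym at≡j+1) , subst (_< at w (suc p)) (sym at≡j+1) j+1<wₚ₊₁))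
    where
    b<p = <-≤-trans b<d d≤p
    p+1<m = ≤-<-trans p<a (subst (a <_) length≡ a<)
    j+1<wₚ₊₁ = ≤∧≢⇒< (≮⇒≥ wₚ₊₁≰j) (≢-sym (≢⇒at≢ (<-trans b<d d<m) p+1<m at≡j+1 (>⇒≢ (<-trans b<p (n<1+n p)))))

  NoLastOcc⇒SmallerLeftOf : ∀ {j b d} → d < b → b < m → at w b ≡ suc j → at w d ≡ j →
                            NoLastOcc (suc j) → SmallerLeftOf w (suc j)
  NoLastOcc⇒SmallerLeftOf {j} {b} {d} d<b b<m at≡j+1 at≡j NLO a b′ a< b′< wₐ≤j at≡j+1′
    with refl ← at-injective (subst (b′ <_) length≡ b′<) b<m (trans at≡j+1′ (sym at≡j+1))
    with <-cmp a b
  ... | tri< a<b _ _ = a<b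
  ... | tri≈ _ refl _ = ⊥-elim (<-irrefl at≡j+1′ wₐ≤j)
  ... | tri> _ _ b<a with crossing-point (λ q → suc j ≤? at w q) b<a (≤-reflexive (sym at≡j+1)) (λ le → <⇒≱ wₐ≤j le)
  ...   | p , b≤p , p<a , j<wₚ , ¬j<wₚ₊₁ =
    ⊥-elim (proj₂ (NLO d p d<p p+1<m) (subst (at w (suc p) <_) (sym at≡j) wₚ₊₁<j , s≤s (≤-reflexive at≡j) , j<wₚ))
    where
    d<p = <-≤-trans d<b b≤p
    p+1<m = ≤-<-trans p<a (subst (a <_) length≡ a<)
    wₚ₊₁<j = ≤∧≢⇒< (≤-pred (≰⇒> ¬j<wₚ₊₁)) (≢⇒at≢ (<-trans d<b b<m) p+1<m at≡j (>⇒≢ (<-trans d<p (n<1+n p))))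

  NoLastOcc⇒AppCondition : ∀ {j} → 1 ≤ m → 1 ≤ j → j ≤ suc m → NoLastOcc j → AppCondition m w j
  NoLastOcc⇒AppCondition {suc zero} 1≤m _ _ _ =
    inj₁ (1≤m , λ a _ a< _ wₐ<1 _ → ⊥-elim (<⇒≱ wₐ<1 (at-≥1 (subst (a <_) length≡ a<))))
  NoLastOcc⇒AppCondition {suc (suc j)} 1≤m _ j+2≤m+1 NLO with suc (suc j) ≤? m
  ... | no j+2≰m = inj₂ (s≤s (s≤s z≤n) , λ a _ a< _ j+1<wₐ _ →
          ⊥-elim (<⇒≱ j+1<wₐ (≤-trans (at-≤ (subst (a <_) length≡ a<)) (≤-pred (≰⇒> j+2≰m)))))
  ... | yes j+2≤m with at-surjective (s≤s z≤n) j+2≤m | at-surjective (s≤s z≤n) (<⇒≤ j+2≤m)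
  ...   | b , b<m , at≡j+2 | d , d<m , at≡j+1 with <-cmp b d
  ...     | tri< b<d _ _ = inj₂ (s≤s (s≤s z≤n) , NoLastOcc⇒LargerLeftOf b<d d<m at≡j+2 at≡j+1 NLO)
  ...     | tri≈ _ refl _ = ⊥-elim (<-irrefl (trans (sym at≡j+1) at≡j+2) ≤-refl)
  ...     | tri> _ _ d<b = inj₁ (j+2≤m , NoLastOcc⇒SmallerLeftOf d<b b<m at≡j+2 at≡j+1 NLO)

  AppCondition⇒NoLastOcc : ∀ {j} → Baxter w → 1 ≤ j → j ≤ suc m → AppCondition m w j → NoLastOcc j
  AppCondition⇒NoLastOcc B 1≤j _ (inj₁ (j≤m , SL)) = SmallerLeftOf⇒NoLastOcc B 1≤j j≤m SL
  AppCondition⇒NoLastOcc B _ (s≤s j≤m) (inj₂ (s≤s 1≤j , LL)) = LargerLeftOf⇒NoLastOcc B 1≤j j≤m LL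

  Baxter-app⇔AppCondition : ∀ {j} → 1 ≤ m → 1 ≤ j → j ≤ suc m → Baxter w → Baxter (app j w) ⇔ AppCondition m w j
  Baxter-app⇔AppCondition 1≤m 1≤j j≤m+1 B = mk⇔
    (λ BA → NoLastOcc⇒AppCondition 1≤m 1≤j j≤m+1 (to (Baxter-app⇔NoLastOcc B) BA))
    (λ cond → from (Baxter-app⇔NoLastOcc B) (AppCondition⇒NoLastOcc B 1≤j j≤m+1 cond))

Baxter-pre⇔PreCondition : ∀ {m w j} → IsPerm m w → 1 ≤ m → 1 ≤ j → j ≤ suc m → Baxter w →
                          Baxter (pre j w) ⇔ PreCondition m w j
Baxter-pre⇔PreCondition {m} {w} {j} w↭ 1≤m 1≤j j≤m+1 B = ⇔-sym right⇔left ⇔-∘ (app-reverse⇔ ⇔-∘ pre⇔app-reverse)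
  where
  pre⇔app-reverse : Baxter (pre j w) ⇔ Baxter (app j (reverse w))
  pre⇔app-reverse = subst (λ u → Baxter (pre j w) ⇔ Baxter u) (reverse-pre j w) (Baxter⇔Baxter-reverse (pre j w))
  app-reverse⇔ : Baxter (app j (reverse w)) ⇔ AppCondition m (reverse w) j
  app-reverse⇔ = Baxter-app⇔AppCondition (isPerm⇒perm (↭-trans (↭-reverse w) w↭)) 1≤m 1≤j j≤m+1 (Baxter-reverse w B)
  right⇔left : PreCondition m w j ⇔ AppCondition m (reverse w) j
  right⇔left = (⇔-id _ ×-⇔ EntriesRightOf⇔EntriesLeftOf-reverse (_< j) w j)
           ⊎-⇔ (⇔-id _ ×-⇔ EntriesRightOf⇔EntriesLeftOf-reverse (j ∸ 1 <_) w (j ∸ 1))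

lemma5p4 : (n : ℕ) → 2 ≤ n → (w : List ℕ) → IsPerm (n ∸ 1) w →
    (j : ℕ) → 1 ≤ j → j ≤ n →
      (app j w ≡ Rccw (insMax (Rcw w) (n + 1 ∸ j)))
    × (pre j w ≡ Rcw (insMax (Rccw w) j))
    × (Baxter w → (Baxter (app j w) ⇔
         ((j ≤ n ∸ 1 × SmallerLeftOf w j) ⊎ (2 ≤ j × LargerLeftOf w (j ∸ 1)))))
    × (Baxter w → (Baxter (pre j w) ⇔
         ((j ≤ n ∸ 1 × SmallerRightOf w j) ⊎ (2 ≤ j × LargerRightOf w (j ∸ 1)))))
lemma5p4 (suc (suc m)) (s≤s (s≤s z≤n)) w w↭ j 1≤j j≤n =
    app≡Rccw-insMax-Rcw P 1≤j j≤n
  , pre≡Rcw-insMax-Rccw P 1≤j j≤n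
  , Baxter-app⇔AppCondition P (s≤s z≤n) 1≤j j≤n
  , Baxter-pre⇔PreCondition w↭ (s≤s z≤n) 1≤j j≤n
  where
  P = isPerm⇒perm w↭
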